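{- Let $\mathcal{O}$ be an $\mathcal{ALCH}$ ontology, $C_0,D_0$ be $\mathcal{ALC}$ concepts, $\Sigma$ a signature, and let $\mathcal{C}\subseteq\mathrm{sub}(\mathcal{O},C_0,D_0)$ be a set of concepts. The following are equivalent: (1) the set $\mathcal{C}$ is $\mathcal{ALC}(\Sigma)$-separable; (2) every completion $T$ of $\mathcal{C}$ is $\mathcal{ALC}(\Sigma)$-separable.
   Context: $\mathrm{sub}(\mathcal{O},C_0,D_0)$ is the set of subconcepts occurring in $\mathcal{O}$, $C_0$, $D_0$, closed under single negation. A type for $\mathcal{O}$ is a set $t\subseteq\mathrm{sub}(\mathcal{O},C_0,D_0)$ such that there is a model $\mathcal{I}$ of $\mathcal{O}$ and an element $d$ with $t=\{E\in\mathrm{sub}(\mathcal{O},C_0,D_0)\mid d\in E^{\mathcal{I}}\}$; a type is treated as the conjunction of its elements. A mosaic is a set of types. A type $t$ is a completion of a concept $C$ if $C\in t$, and a mosaic $T$ is a completion of a set $\mathcal{C}$ of concepts if $T$ contains a completion of every $C\in\mathcal{C}$. An $\mathcal{ALC}(\Sigma)$ separator for a set $\mathcal{C}$ of concepts is a function $\mathsf{Sep}$ from $\mathcal{C}$ to $\mathcal{ALC}(\Sigma)$ concepts (concepts using only concept and role names from $\Sigma$) such that $\mathcal{O}\models C\sqsubseteq\mathsf{Sep}(C)$ for every $C\in\mathcal{C}$ and $\mathcal{O}\models$ (the conjunction $\sqcap$ of all $\mathsf{Sep}(C)$, $C\in\mathcal{C}$) $\sqsubseteq\bot$. $\mathcal{C}$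 is $\mathcal{ALC}(\Sigma)$-separable if an $\mathcal{ALC}(\Sigma)$ separator for $\mathcal{C}$ exists. -}

module Defs where

open import Data.Nat using (ℕ)
open import Data.Bool using (Bool; true; false; not; _∧_; _∨_)
open import Data.List using (List; []; _∷_; map; foldr)
open import Data.List.Membership.Propositional using (_∈_)
open import Data.List.Relation.Unary.All using (All)
open import Data.List.Relation.Unary.Any using (Any)
open import Data.Product using (Σ; _×_; _,_; ∃)
open import Relation.Binary.PropositionalEquality using (_≡_)

ConceptName : Set
ConceptName = ℕ

RoleName : Set
RoleName = ℕ

data Concept : Set where
  ⊤c ⊥c : Concept
  atom  : ConceptName → Concept
  ¬c_   : Concept → Concept
  _⊓_   : Concept → Concept → Concept
  _⊔_   : Concept → Concept → Concept
  ∃c    : RoleName → Concept → Concept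
  ∀c    : RoleName → Concept → Concept

record Ontology : Set where
  field
    cis : List (Concept × Concept)
    ris : List (RoleName × RoleName)
open Ontology public

-- Interpretations. Concept extensions are Bool-valued (so that the
-- semantics is classical), constrained by the usual compositional clauses.
record Interp : Set₁ where
  field
    Δ    : Set
    ext  : Concept → Δ → Bool
    rol  : RoleName → Δ → Δ → Set
    ext-⊤ : ∀ d → ext ⊤c d ≡ true
    ext-⊥ : ∀ d → ext ⊥c d ≡ false
    ext-¬ : ∀ C d → ext (¬c C) d ≡ not (ext C d)
    ext-⊓ : ∀ C D d → ext (C ⊓ D) d ≡ (ext C d ∧ ext D d)
    ext-⊔ : ∀ C D d → ext (C ⊔ D) d ≡ (ext C d ∨ ext D d)
    ext-∃⇒ : ∀ r C d → ext (∃c r C) d ≡ true → Σ Δ (λ e → rol r d e × ext C e ≡ true)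
    ext-∃⇐ : ∀ r C d e → rol r d e → ext C e ≡ true → ext (∃c r C) d ≡ true
    ext-∀⇒ : ∀ r C d → ext (∀c r C) d ≡ true → ∀ e → rol r d e → ext C e ≡ true
    ext-∀⇐ : ∀ r C d → (∀ e → rol r d e → ext C e ≡ true) → ext (∀c r C) d ≡ true
open Interp public

IsModel : Ontology → Interp → Set
IsModel O I =
  All (λ { (C , D) → ∀ d → ext I C d ≡ true → ext I D d ≡ true }) (cis O) ×
  All (λ { (r , s) → ∀ d e → rol I r d e → rol I s d e }) (ris O)

_⊨_⊑_ : Ontology → Concept → Concept → Set₁
O ⊨ C ⊑ D = (I : Interp) → IsModel O I → ∀ d → ext I C d ≡ true → ext I D d ≡ true

data SubC : Concept → Concept → Set where
  refl  : ∀ {C} → SubC C C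
  sub¬  : ∀ {E C} → SubC E C → SubC E (¬c C)
  sub⊓ˡ : ∀ {E C D} → SubC E C → SubC E (C ⊓ D)
  sub⊓ʳ : ∀ {E C D} → SubC E D → SubC E (C ⊓ D)
  sub⊔ˡ : ∀ {E C D} → SubC E C → SubC E (C ⊔ D)
  sub⊔ʳ : ∀ {E C D} → SubC E D → SubC E (C ⊔ D)
  sub∃  : ∀ {E r C} → SubC E C → SubC E (∃c r C)
  sub∀  : ∀ {E r C} → SubC E C → SubC E (∀c r C)

data Occurs (O : Ontology) (C₀ D₀ : Concept) : Concept → Set where
  inC₀ : ∀ {E} → SubC E C₀ → Occurs O C₀ D₀ E
  inD₀ : ∀ {E} → SubC E D₀ → Occurs O C₀ D₀ E
  inLhs : ∀ {E C D} → (C , D) ∈ cis O → SubC E C → Occurs O C₀ D₀ E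
  inRhs : ∀ {E C D} → (C , D) ∈ cis O → SubC E D → Occurs O C₀ D₀ E

data InSub (O : Ontology) (C₀ D₀ : Concept) : Concept → Set where
  occ : ∀ {E} → Occurs O C₀ D₀ E → InSub O C₀ D₀ E
  neg : ∀ {E} → Occurs O C₀ D₀ E → InSub O C₀ D₀ (¬c E)

conj : List Concept → Concept
conj = foldr _⊓_ ⊤c

IsType : Ontology → Concept → Concept → List Concept → Set₁
IsType O C₀ D₀ t =
  All (InSub O C₀ D₀) t ×
  Σ Interp (λ I → IsModel O I × Σ (Δ I) (λ d →
    ∀ E → InSub O C₀ D₀ E → (E ∈ t → ext I E d ≡ true) × (ext I E d ≡ true → E ∈ t)))

IsCompletionOf : Concept → List Concept → Set
IsCompletionOf C t = C ∈ t

IsMosaicCompletion : Ontology → Concept → Concept → List Concept → List (List Concept) → Set₁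
IsMosaicCompletion O C₀ D₀ 𝒞 T =
  All (IsType O C₀ D₀) T ×
  All (λ C → Any (IsCompletionOf C) T) 𝒞

record Signature : Set where
  field
    cnames : List ConceptName
    rnames : List RoleName
open Signature public

data InSig (Σs : Signature) : Concept → Set where
  ⊤s : InSig Σs ⊤c
  ⊥s : InSig Σs ⊥c
  atoms : ∀ {A} → A ∈ cnames Σs → InSig Σs (atom A)
  ¬s : ∀ {C} → InSig Σs C → InSig Σs (¬c C)
  ⊓s : ∀ {C D} → InSig Σs C → InSig Σs D → InSig Σs (C ⊓ D)
  ⊔s : ∀ {C D} → InSig Σs C → InSig Σs D → InSig Σs (C ⊔ D)
  ∃s : ∀ {r C} → r ∈ rnames Σs → InSig Σs C → InSig Σs (∃c r C)
  ∀s : ∀ {r C} → r ∈ rnames Σs → InSig Σs C → InSig Σs (∀c r C)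

IsSeparator : Ontology → Signature → List Concept → (Concept → Concept) → Set₁
IsSeparator O Σs 𝒞 Sep =
  All (λ C → InSig Σs (Sep C) × (O ⊨ C ⊑ Sep C)) 𝒞 ×
  (O ⊨ conj (map Sep 𝒞) ⊑ ⊥c)

Separable : Ontology → Signature → List Concept → Set₁
Separable O Σs 𝒞 = Σ (Concept → Concept) (IsSeparator O Σs 𝒞)

MosaicSeparable : Ontology → Signature → List (List Concept) → Set₁
MosaicSeparable O Σs T = Separable O Σs (map conj T)

{-# OPTIONS --safe #-}
module Submission where

-- (1)⇒(2): a type t of a completion T is separated by the conjunction of the separators of
-- those members of 𝒞 that are conjuncts of t; as every member of 𝒞 lies in some type of T,
-- these conjunctions are jointly unsatisfiable.
-- (2)⇒(1): type elimination, which prunes from the locally consistent subsets of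
-- sub(O, C₀, D₀) those having an unwitnessed ∃r.F or ¬∀r.F, computes exactly the types of O:
-- the survivors form a canonical model realising each of them, and the type of an element of
-- any model is never pruned. Hence there are finitely many mosaics, and (2) gives a separator
-- Sep_T for each completion T. Let Sep C be the disjunction, over the types t ∋ C, of the
-- conjunction of Sep_T(t) over the mosaics T ∋ t. An element of C satisfies the disjunct of
-- its own type. An element d of every Sep C singles out the mosaic T of all types whose
-- disjunct holds at d; T is a completion, and d would satisfy every Sep_T(t) for t ∈ T.

open import Defs
open import Data.List using (List)
open import Data.List.Relation.Unary.All using (All)
open import Data.Product using (_×_)

open import Level using (0ℓ)
open import Function using (_∘_; id)
open import Function.Bundles using (_⇔_; mk⇔; module Equivalence)
open import Function.Construct.Composition using (_⇔-∘_)
open import Function.Construct.Symmetry using (⇔-sym)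
open import Function.Construct.Identity using (⇔-id)
open import Function.Related.TypeIsomorphisms using (¬-cong-⇔)
open import Data.Empty using (⊥; ⊥-elim)
open import Data.Unit using (⊤; tt)
open import Data.Bool using (true; false)
open import Data.Bool.Properties using (not-¬)
import Data.Bool as Bool
import Data.Nat as ℕ
open import Data.Nat.Induction using (<-wellFounded)
open import Induction.WellFounded using (Acc; acc)
open import Data.Product using (Σ; _,_; proj₁; proj₂; uncurry)
import Data.Product as Product
open import Data.Product.Function.NonDependent.Propositional using (_×-⇔_)
open import Data.Sum using (_⊎_; inj₁; inj₂; [_,_]; [_,_]′)
import Data.Sum as Sum
open import Data.Sum.Function.Propositional using (_⊎-⇔_)
open import Data.List using ([]; _∷_; _++_; map; filter; concatMap; foldr; length)
open import Data.List.Properties using (filter-notAll; ≡-dec)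
open import Data.List.Relation.Unary.Any using (Any; here; there; any?)
import Data.List.Relation.Unary.Any as Any
import Data.List.Relation.Unary.Any.Properties as Any
open import Data.List.Relation.Unary.All using ([]; _∷_; all?)
import Data.List.Relation.Unary.All as All
import Data.List.Relation.Unary.All.Properties as All
open import Data.List.Membership.Propositional using (_∈_; _∉_; find; lose)
open import Data.List.Membership.Propositional.Properties
  using (∈-map⁺; ∈-map⁻; ∈-++⁺ˡ; ∈-++⁺ʳ; ∈-++⁻; ∈-filter⁺; ∈-filter⁻; ∈-concatMap⁺; ∈-concatMap⁻)
import Data.List.Membership.DecPropositional as DecMembership
open import Data.List.Relation.Binary.Subset.Propositional using (_⊆_)
open import Relation.Binary.Construct.Closure.ReflexiveTransitive using (Star; ε; _◅_; _◅◅_)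
import Relation.Binary.Construct.Closure.ReflexiveTransitive as Star
open import Relation.Binary.Definitions using (DecidableEquality)
open import Relation.Nullary using (Dec; yes; no; does; ¬_)
open import Relation.Nullary.Decidable using (map′; _×-dec_; _⊎-dec_; _→-dec_; ¬?; dec-true)
import Relation.Nullary.Decidable as Dec
open import Relation.Unary using (Pred; Decidable)
open import Relation.Binary.PropositionalEquality using (_≡_; refl; cong; cong₂; subst)

dec-true⁻¹ : ∀ {a} {A : Set a} (a? : Dec A) → does a? ≡ true → A
dec-true⁻¹ (yes a) _ = a
dec-true⁻¹ (no _) ()

infix 0 _⇔?_
_⇔?_ : ∀ {a b} {A : Set a} {B : Set b} → Dec A → Dec B → Dec (A ⇔ B)
a? ⇔? b? = map′ (uncurry mk⇔) (λ A⇔B → Equivalence.to A⇔B , Equivalence.from A⇔B)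
                ((a? →-dec b?) ×-dec (b? →-dec a?))

module _ {A : Set} where

  sublists : List A → List (List A)
  sublists []       = [] ∷ []
  sublists (x ∷ xs) = map (x ∷_) (sublists xs) ++ sublists xs

  filter-∈-sublists : ∀ {P : Pred A 0ℓ} (P? : Decidable P) xs → filter P? xs ∈ sublists xs
  filter-∈-sublists P? []       = here refl
  filter-∈-sublists P? (x ∷ xs) with does (P? x)
  ... | true  = ∈-++⁺ˡ (∈-map⁺ (x ∷_) (filter-∈-sublists P? xs))
  ... | false = ∈-++⁺ʳ (map (x ∷_) (sublists xs)) (filter-∈-sublists P? xs)

  ∈-sublists⇒⊆ : ∀ {xs ys} → ys ∈ sublists xs → ys ⊆ xs
  ∈-sublists⇒⊆ {[]}     (here refl) ()
  ∈-sublists⇒⊆ {x ∷ xs} ys∈ y∈ with ∈-++⁻ (map (x ∷_) (sublists xs)) ys∈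
  ... | inj₂ ys∈′ = there (∈-sublists⇒⊆ ys∈′ y∈)
  ... | inj₁ x∷zs∈ with ∈-map⁻ (x ∷_) x∷zs∈ | y∈
  ...   | _ , _    , refl | here refl = here refl
  ...   | _ , zs∈ , refl | there y∈′ = there (∈-sublists⇒⊆ zs∈ y∈′)

module Pruning {A : Set} (W : List A → Pred A 0ℓ) (W? : ∀ L → Decidable (W L)) where

  private
    shrinks : ∀ L → ¬ All (W L) L → length (filter (W? L) L) ℕ.< length L
    shrinks L ¬all = filter-notAll (W? L) L (All.¬All⇒Any¬ (W? L) L ¬all)

    pruneAcc : (L : List A) → Acc ℕ._<_ (length L) → List A
    pruneAcc L (acc rec) with all? (W? L) L
    ... | yes _    = L
    ... | no ¬all = pruneAcc (filter (W? L) L) (rec (shrinks L ¬all))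

    pruneAcc-⊆ : ∀ L a → pruneAcc L a ⊆ L
    pruneAcc-⊆ L (acc rec) with all? (W? L) L
    ... | yes _    = id
    ... | no ¬all = proj₁ ∘ ∈-filter⁻ (W? L) ∘ pruneAcc-⊆ _ (rec (shrinks L ¬all))

    pruneAcc-stable : ∀ L a → All (W (pruneAcc L a)) (pruneAcc L a)
    pruneAcc-stable L (acc rec) with all? (W? L) L
    ... | yes all = all
    ... | no ¬all = pruneAcc-stable _ (rec (shrinks L ¬all))

    pruneAcc-keeps : ∀ {D : Set} (f : D → A) → (∀ {L} → (∀ d → f d ∈ L) → ∀ d → W L (f d)) →
                     ∀ L a → (∀ d → f d ∈ L) → ∀ d → f d ∈ pruneAcc L a
    pruneAcc-keeps f step L (acc rec) f∈L with all? (W? L) L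
    ... | yes _    = f∈L
    ... | no ¬all = pruneAcc-keeps f step _ (rec (shrinks L ¬all))
                      (λ d → ∈-filter⁺ (W? L) (f∈L d) (step f∈L d))

  prune : List A → List A
  prune L = pruneAcc L (<-wellFounded (length L))

  prune-⊆ : ∀ L → prune L ⊆ L
  prune-⊆ L = pruneAcc-⊆ L _

  prune-stable : ∀ L → All (W (prune L)) (prune L)
  prune-stable L = pruneAcc-stable L _

  prune-keeps : ∀ {D : Set} (f : D → A) → (∀ {L} → (∀ d → f d ∈ L) → ∀ d → W L (f d)) →
                ∀ L → (∀ d → f d ∈ L) → ∀ d → f d ∈ prune L
  prune-keeps f step L = pruneAcc-keeps f step L _

module _ {A : Set} where

  Reachable : List (A × A) → A → A → Set
  Reachable G = Star (λ a b → (a , b) ∈ G)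

  -- A path through the edge (u , v) splits at the first and at the last use of that edge.
  reachable-∷ : ∀ {u v G a b} →
                Reachable ((u , v) ∷ G) a b ⇔ (Reachable G a b ⊎ Reachable G a u × Reachable G v b)
  reachable-∷ {u} {v} {G} = mk⇔ split join
    where
    weaken : ∀ {a b} → Reachable G a b → Reachable ((u , v) ∷ G) a b
    weaken = Star.map there
    split : ∀ {a b} → Reachable ((u , v) ∷ G) a b → Reachable G a b ⊎ Reachable G a u × Reachable G v b
    split ε                = inj₁ ε
    split (here refl ◅ p)  = inj₂ (ε , [ id , proj₂ ] (split p))
    split (there uv ◅ p)   = Sum.map (uv ◅_) (Product.map₁ (uv ◅_)) (split p)
    join : ∀ {a b} → Reachable G a b ⊎ Reachable G a u × Reachable G v b → Reachable ((u , v) ∷ G) a b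
    join (inj₁ p)       = weaken p
    join (inj₂ (p , q)) = weaken p ◅◅ here refl ◅ weaken q

  reachable? : DecidableEquality A → ∀ G a b → Dec (Reachable G a b)
  reachable? _≟_ []            a b = map′ (λ { refl → ε }) (λ { ε → refl ; (() ◅ _) }) (a ≟ b)
  reachable? _≟_ ((u , v) ∷ G) a b =
    Dec.map (⇔-sym reachable-∷)
      (reachable? _≟_ G a b ⊎-dec reachable? _≟_ G a u ×-dec reachable? _≟_ G v b)

infix 4 _≟ᶜ_
_≟ᶜ_ : DecidableEquality Concept
⊤c ≟ᶜ ⊤c = yes refl
⊤c ≟ᶜ ⊥c = no λ ()
⊤c ≟ᶜ atom _ = no λ ()
⊤c ≟ᶜ ¬c _ = no λ ()
⊤c ≟ᶜ _ ⊓ _ = no λ ()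
⊤c ≟ᶜ _ ⊔ _ = no λ ()
⊤c ≟ᶜ ∃c _ _ = no λ ()
⊤c ≟ᶜ ∀c _ _ = no λ ()
⊥c ≟ᶜ ⊤c = no λ ()
⊥c ≟ᶜ ⊥c = yes refl
⊥c ≟ᶜ atom _ = no λ ()
⊥c ≟ᶜ ¬c _ = no λ ()
⊥c ≟ᶜ _ ⊓ _ = no λ ()
⊥c ≟ᶜ _ ⊔ _ = no λ ()
⊥c ≟ᶜ ∃c _ _ = no λ ()
⊥c ≟ᶜ ∀c _ _ = no λ ()
atom _ ≟ᶜ ⊤c = no λ ()
atom _ ≟ᶜ ⊥c = no λ ()
atom A ≟ᶜ atom B = map′ (cong atom) (λ { refl → refl }) (A ℕ.≟ B)
atom _ ≟ᶜ ¬c _ = no λ ()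
atom _ ≟ᶜ _ ⊓ _ = no λ ()
atom _ ≟ᶜ _ ⊔ _ = no λ ()
atom _ ≟ᶜ ∃c _ _ = no λ ()
atom _ ≟ᶜ ∀c _ _ = no λ ()
¬c _ ≟ᶜ ⊤c = no λ ()
¬c _ ≟ᶜ ⊥c = no λ ()
¬c _ ≟ᶜ atom _ = no λ ()
¬c C ≟ᶜ ¬c D = map′ (cong ¬c_) (λ { refl → refl }) (C ≟ᶜ D)
¬c _ ≟ᶜ _ ⊓ _ = no λ ()
¬c _ ≟ᶜ _ ⊔ _ = no λ ()
¬c _ ≟ᶜ ∃c _ _ = no λ ()
¬c _ ≟ᶜ ∀c _ _ = no λ ()
_ ⊓ _ ≟ᶜ ⊤c = no λ ()
_ ⊓ _ ≟ᶜ ⊥c = no λ ()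
_ ⊓ _ ≟ᶜ atom _ = no λ ()
_ ⊓ _ ≟ᶜ ¬c _ = no λ ()
C ⊓ D ≟ᶜ C′ ⊓ D′ = map′ (uncurry (cong₂ _⊓_)) (λ { refl → refl , refl }) (C ≟ᶜ C′ ×-dec D ≟ᶜ D′)
_ ⊓ _ ≟ᶜ _ ⊔ _ = no λ ()
_ ⊓ _ ≟ᶜ ∃c _ _ = no λ ()
_ ⊓ _ ≟ᶜ ∀c _ _ = no λ ()
_ ⊔ _ ≟ᶜ ⊤c = no λ ()
_ ⊔ _ ≟ᶜ ⊥c = no λ ()
_ ⊔ _ ≟ᶜ atom _ = no λ ()
_ ⊔ _ ≟ᶜ ¬c _ = no λ ()
_ ⊔ _ ≟ᶜ _ ⊓ _ = no λ ()
C ⊔ D ≟ᶜ C′ ⊔ D′ = map′ (uncurry (cong₂ _⊔_)) (λ { refl → refl , refl }) (C ≟ᶜ C′ ×-dec D ≟ᶜ D′)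
_ ⊔ _ ≟ᶜ ∃c _ _ = no λ ()
_ ⊔ _ ≟ᶜ ∀c _ _ = no λ ()
∃c _ _ ≟ᶜ ⊤c = no λ ()
∃c _ _ ≟ᶜ ⊥c = no λ ()
∃c _ _ ≟ᶜ atom _ = no λ ()
∃c _ _ ≟ᶜ ¬c _ = no λ ()
∃c _ _ ≟ᶜ _ ⊓ _ = no λ ()
∃c _ _ ≟ᶜ _ ⊔ _ = no λ ()
∃c r C ≟ᶜ ∃c s D = map′ (uncurry (cong₂ ∃c)) (λ { refl → refl , refl }) (r ℕ.≟ s ×-dec C ≟ᶜ D)
∃c _ _ ≟ᶜ ∀c _ _ = no λ ()
∀c _ _ ≟ᶜ ⊤c = no λ ()
∀c _ _ ≟ᶜ ⊥c = no λ ()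
∀c _ _ ≟ᶜ atom _ = no λ ()
∀c _ _ ≟ᶜ ¬c _ = no λ ()
∀c _ _ ≟ᶜ _ ⊓ _ = no λ ()
∀c _ _ ≟ᶜ _ ⊔ _ = no λ ()
∀c _ _ ≟ᶜ ∃c _ _ = no λ ()
∀c r C ≟ᶜ ∀c s D = map′ (uncurry (cong₂ ∀c)) (λ { refl → refl , refl }) (r ℕ.≟ s ×-dec C ≟ᶜ D)

mutual
  subconcepts : Concept → List Concept
  subconcepts C = C ∷ strictSubconcepts C

  strictSubconcepts : Concept → List Concept
  strictSubconcepts (¬c C)   = subconcepts C
  strictSubconcepts (C ⊓ D)  = subconcepts C ++ subconcepts D
  strictSubconcepts (C ⊔ D)  = subconcepts C ++ subconcepts D
  strictSubconcepts (∃c _ C) = subconcepts C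
  strictSubconcepts (∀c _ C) = subconcepts C
  strictSubconcepts _        = []

SubC⇒∈subconcepts : ∀ {E C} → SubC E C → E ∈ subconcepts C
SubC⇒∈subconcepts refl                = here refl
SubC⇒∈subconcepts (sub¬ s)            = there (SubC⇒∈subconcepts s)
SubC⇒∈subconcepts (sub⊓ˡ s)           = there (∈-++⁺ˡ (SubC⇒∈subconcepts s))
SubC⇒∈subconcepts {C = C ⊓ _} (sub⊓ʳ s) = there (∈-++⁺ʳ (subconcepts C) (SubC⇒∈subconcepts s))
SubC⇒∈subconcepts (sub⊔ˡ s)           = there (∈-++⁺ˡ (SubC⇒∈subconcepts s))
SubC⇒∈subconcepts {C = C ⊔ _} (sub⊔ʳ s) = there (∈-++⁺ʳ (subconcepts C) (SubC⇒∈subconcepts s))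
SubC⇒∈subconcepts (sub∃ s)            = there (SubC⇒∈subconcepts s)
SubC⇒∈subconcepts (sub∀ s)            = there (SubC⇒∈subconcepts s)

∈subconcepts⇒SubC : ∀ {E} C → E ∈ subconcepts C → SubC E C
∈subconcepts⇒SubC C        (here refl) = refl
∈subconcepts⇒SubC (¬c C)   (there E∈)  = sub¬ (∈subconcepts⇒SubC C E∈)
∈subconcepts⇒SubC (C ⊓ D)  (there E∈) with ∈-++⁻ (subconcepts C) E∈
... | inj₁ E∈C = sub⊓ˡ (∈subconcepts⇒SubC C E∈C)
... | inj₂ E∈D = sub⊓ʳ (∈subconcepts⇒SubC D E∈D)
∈subconcepts⇒SubC (C ⊔ D)  (there E∈) with ∈-++⁻ (subconcepts C) E∈
... | inj₁ E∈C = sub⊔ˡ (∈subconcepts⇒SubC C E∈C)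
... | inj₂ E∈D = sub⊔ʳ (∈subconcepts⇒SubC D E∈D)
∈subconcepts⇒SubC (∃c _ C) (there E∈)  = sub∃ (∈subconcepts⇒SubC C E∈)
∈subconcepts⇒SubC (∀c _ C) (there E∈)  = sub∀ (∈subconcepts⇒SubC C E∈)

SubC-trans : ∀ {E F G} → SubC E F → SubC F G → SubC E G
SubC-trans s refl      = s
SubC-trans s (sub¬ t)  = sub¬ (SubC-trans s t)
SubC-trans s (sub⊓ˡ t) = sub⊓ˡ (SubC-trans s t)
SubC-trans s (sub⊓ʳ t) = sub⊓ʳ (SubC-trans s t)
SubC-trans s (sub⊔ˡ t) = sub⊔ˡ (SubC-trans s t)
SubC-trans s (sub⊔ʳ t) = sub⊔ʳ (SubC-trans s t)
SubC-trans s (sub∃ t)  = sub∃ (SubC-trans s t)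
SubC-trans s (sub∀ t)  = sub∀ (SubC-trans s t)

module Sub (O : Ontology) (C₀ D₀ : Concept) where

  inclusionSubconcepts : Concept × Concept → List Concept
  inclusionSubconcepts (C , D) = subconcepts C ++ subconcepts D

  occurring : List Concept
  occurring = subconcepts C₀ ++ subconcepts D₀ ++ concatMap inclusionSubconcepts (cis O)

  sub : List Concept
  sub = occurring ++ map ¬c_ occurring

  inclusionSubconcepts⊆occurring : ∀ {CD E} → CD ∈ cis O → E ∈ inclusionSubconcepts CD → E ∈ occurring
  inclusionSubconcepts⊆occurring CD∈ E∈ = ∈-++⁺ʳ (subconcepts C₀) (∈-++⁺ʳ (subconcepts D₀)
    (∈-concatMap⁺ inclusionSubconcepts (lose CD∈ E∈)))

  Occurs⇒∈ : ∀ {E} → Occurs O C₀ D₀ E → E ∈ occurring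
  Occurs⇒∈ (inC₀ s)            = ∈-++⁺ˡ (SubC⇒∈subconcepts s)
  Occurs⇒∈ (inD₀ s)            = ∈-++⁺ʳ (subconcepts C₀) (∈-++⁺ˡ (SubC⇒∈subconcepts s))
  Occurs⇒∈ (inLhs m s)         = inclusionSubconcepts⊆occurring m (∈-++⁺ˡ (SubC⇒∈subconcepts s))
  Occurs⇒∈ (inRhs {C = C} m s) =
    inclusionSubconcepts⊆occurring m (∈-++⁺ʳ (subconcepts C) (SubC⇒∈subconcepts s))

  ∈⇒Occurs : ∀ {E} → E ∈ occurring → Occurs O C₀ D₀ E
  ∈⇒Occurs E∈ with ∈-++⁻ (subconcepts C₀) E∈
  ... | inj₁ E∈C₀ = inC₀ (∈subconcepts⇒SubC C₀ E∈C₀)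
  ... | inj₂ E∈′ with ∈-++⁻ (subconcepts D₀) E∈′
  ...   | inj₁ E∈D₀ = inD₀ (∈subconcepts⇒SubC D₀ E∈D₀)
  ...   | inj₂ E∈cis with find (∈-concatMap⁻ inclusionSubconcepts {xs = cis O} E∈cis)
  ...     | (C , D) , CD∈ , E∈CD with ∈-++⁻ (subconcepts C) E∈CD
  ...       | inj₁ E∈C = inLhs CD∈ (∈subconcepts⇒SubC C E∈C)
  ...       | inj₂ E∈D = inRhs CD∈ (∈subconcepts⇒SubC D E∈D)

  InSub⇒∈ : ∀ {E} → InSub O C₀ D₀ E → E ∈ sub
  InSub⇒∈ (occ o) = ∈-++⁺ˡ (Occurs⇒∈ o)
  InSub⇒∈ (neg o) = ∈-++⁺ʳ occurring (∈-map⁺ ¬c_ (Occurs⇒∈ o))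

  ∈⇒InSub : ∀ {E} → E ∈ sub → InSub O C₀ D₀ E
  ∈⇒InSub E∈ with ∈-++⁻ occurring E∈
  ... | inj₁ E∈′ = occ (∈⇒Occurs E∈′)
  ... | inj₂ E∈′ with ∈-map⁻ ¬c_ E∈′
  ...   | _ , F∈ , refl = neg (∈⇒Occurs F∈)

  Occurs-SubC : ∀ {E F} → SubC F E → Occurs O C₀ D₀ E → Occurs O C₀ D₀ F
  Occurs-SubC s (inC₀ t)    = inC₀ (SubC-trans s t)
  Occurs-SubC s (inD₀ t)    = inD₀ (SubC-trans s t)
  Occurs-SubC s (inLhs m t) = inLhs m (SubC-trans s t)
  Occurs-SubC s (inRhs m t) = inRhs m (SubC-trans s t)

  InSub-¬ : ∀ {F} → InSub O C₀ D₀ (¬c F) → InSub O C₀ D₀ F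
  InSub-¬ (occ o) = occ (Occurs-SubC (sub¬ refl) o)
  InSub-¬ (neg o) = occ o

  InSub-⊓ : ∀ {F G} → InSub O C₀ D₀ (F ⊓ G) → InSub O C₀ D₀ F × InSub O C₀ D₀ G
  InSub-⊓ (occ o) = occ (Occurs-SubC (sub⊓ˡ refl) o) , occ (Occurs-SubC (sub⊓ʳ refl) o)

  InSub-⊔ : ∀ {F G} → InSub O C₀ D₀ (F ⊔ G) → InSub O C₀ D₀ F × InSub O C₀ D₀ G
  InSub-⊔ (occ o) = occ (Occurs-SubC (sub⊔ˡ refl) o) , occ (Occurs-SubC (sub⊔ʳ refl) o)

  InSub-∃ : ∀ {r F} → InSub O C₀ D₀ (∃c r F) → InSub O C₀ D₀ F
  InSub-∃ (occ o) = occ (Occurs-SubC (sub∃ refl) o)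

  InSub-∀ : ∀ {r F} → InSub O C₀ D₀ (∀c r F) → InSub O C₀ D₀ F
  InSub-∀ (occ o) = occ (Occurs-SubC (sub∀ refl) o)

open DecMembership _≟ᶜ_ using (_∈?_)
open DecMembership (≡-dec _≟ᶜ_) using () renaming (_∈?_ to _∈ᴸ?_)

disj : List Concept → Concept
disj = foldr _⊔_ ⊥c

conj-InSig : ∀ {Σs Cs} → All (InSig Σs) Cs → InSig Σs (conj Cs)
conj-InSig []       = ⊤s
conj-InSig (s ∷ ss) = ⊓s s (conj-InSig ss)

disj-InSig : ∀ {Σs Cs} → All (InSig Σs) Cs → InSig Σs (disj Cs)
disj-InSig []       = ⊥s
disj-InSig (s ∷ ss) = ⊔s s (disj-InSig ss)

module Semantics (I : Interp) where
  open Equivalence using (to; from)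

  infix 4 _∈⟦_⟧
  _∈⟦_⟧ : Δ I → Concept → Set
  d ∈⟦ C ⟧ = ext I C d ≡ true

  _∈⟦_⟧? : ∀ d C → Dec (d ∈⟦ C ⟧)
  d ∈⟦ C ⟧? = ext I C d Bool.≟ true

  ∈⟦⊤⟧ : ∀ {d} → d ∈⟦ ⊤c ⟧
  ∈⟦⊤⟧ {d} = ext-⊤ I d

  ∉⟦⊥⟧ : ∀ {d} → ¬ d ∈⟦ ⊥c ⟧
  ∉⟦⊥⟧ {d} = not-¬ (ext-⊥ I d)

  ∈⟦¬⟧ : ∀ {C d} → d ∈⟦ ¬c C ⟧ ⇔ (¬ d ∈⟦ C ⟧)
  ∈⟦¬⟧ {C} {d} rewrite ext-¬ I C d with ext I C d
  ... | true  = mk⇔ (λ ()) (λ ¬t → ⊥-elim (¬t refl))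
  ... | false = mk⇔ (λ _ ()) (λ _ → refl)

  ∈⟦⊓⟧ : ∀ {C D d} → d ∈⟦ C ⊓ D ⟧ ⇔ (d ∈⟦ C ⟧ × d ∈⟦ D ⟧)
  ∈⟦⊓⟧ {C} {D} {d} rewrite ext-⊓ I C D d with ext I C d
  ... | true  = mk⇔ (refl ,_) proj₂
  ... | false = mk⇔ (λ ()) (λ { (() , _) })

  ∈⟦⊔⟧ : ∀ {C D d} → d ∈⟦ C ⊔ D ⟧ ⇔ (d ∈⟦ C ⟧ ⊎ d ∈⟦ D ⟧)
  ∈⟦⊔⟧ {C} {D} {d} rewrite ext-⊔ I C D d with ext I C d
  ... | true  = mk⇔ (λ _ → inj₁ refl) (λ _ → refl)
  ... | false = mk⇔ inj₂ (λ { (inj₁ ()) ; (inj₂ e) → e })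

  ∈⟦conj⟧ : ∀ {Cs d} → d ∈⟦ conj Cs ⟧ ⇔ All (d ∈⟦_⟧) Cs
  ∈⟦conj⟧ {[]}     = mk⇔ (λ _ → []) (λ _ → ∈⟦⊤⟧)
  ∈⟦conj⟧ {C ∷ Cs} = mk⇔
    (λ d∈ → let d∈C , d∈Cs = to ∈⟦⊓⟧ d∈ in d∈C ∷ to ∈⟦conj⟧ d∈Cs)
    (λ { (d∈C ∷ d∈Cs) → from ∈⟦⊓⟧ (d∈C , from ∈⟦conj⟧ d∈Cs) })

  ∈⟦disj⟧ : ∀ {Cs d} → d ∈⟦ disj Cs ⟧ ⇔ Any (d ∈⟦_⟧) Cs
  ∈⟦disj⟧ {[]}     = mk⇔ (⊥-elim ∘ ∉⟦⊥⟧) λ ()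
  ∈⟦disj⟧ {C ∷ Cs} = mk⇔
    (λ d∈ → [ here , there ∘ to (∈⟦disj⟧ {Cs}) ]′ (to ∈⟦⊔⟧ d∈))
    (λ { (here d∈C) → from ∈⟦⊔⟧ (inj₁ d∈C)
       ; (there d∈Cs) → from ∈⟦⊔⟧ (inj₂ (from ∈⟦disj⟧ d∈Cs)) })

  ∈⟦conj-map⟧ : ∀ {A : Set} {f : A → Concept} {xs d} →
                d ∈⟦ conj (map f xs) ⟧ ⇔ All (λ x → d ∈⟦ f x ⟧) xs
  ∈⟦conj-map⟧ = mk⇔ (All.map⁻ ∘ to ∈⟦conj⟧) (from ∈⟦conj⟧ ∘ All.map⁺)

  ∈⟦disj-map⟧ : ∀ {A : Set} {f : A → Concept} {xs d} →
                d ∈⟦ disj (map f xs) ⟧ ⇔ Any (λ x → d ∈⟦ f x ⟧) xs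
  ∈⟦disj-map⟧ = mk⇔ (Any.map⁻ ∘ to ∈⟦disj⟧) (from ∈⟦disj⟧ ∘ Any.map⁺)

  -- Constructive because ∃r.¬C has a Boolean extension we can inspect.
  ∉⟦∀⟧⇒counterexample : ∀ {r C d} → ¬ d ∈⟦ ∀c r C ⟧ → Σ (Δ I) λ e → rol I r d e × ¬ e ∈⟦ C ⟧
  ∉⟦∀⟧⇒counterexample {r} {C} {d} d∉ with ext I (∃c r (¬c C)) d in ∃¬C?
  ... | true  = let e , de , e∈¬C = ext-∃⇒ I r (¬c C) d ∃¬C? in e , de , to ∈⟦¬⟧ e∈¬C
  ... | false = ⊥-elim (d∉ (ext-∀⇐ I r C d all))
    where
    all : ∀ e → rol I r d e → e ∈⟦ C ⟧
    all e de with ext I C e in C?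
    ... | true  = refl
    ... | false = ⊥-elim (not-¬ ∃¬C? (ext-∃⇐ I r (¬c C) d e de (from ∈⟦¬⟧ (not-¬ C?))))

module TypeElimination (O : Ontology) (C₀ D₀ : Concept) where
  open Sub O C₀ D₀
  open Equivalence using (to; from)

  infix 4 _⊑*_
  _⊑*_ : RoleName → RoleName → Set
  _⊑*_ = Reachable (ris O)

  Local : List Concept → Concept → Set
  Local t ⊤c       = ⊤c ∈ t ⇔ ⊤
  Local t ⊥c       = ⊥c ∈ t ⇔ ⊥
  Local t (¬c F)   = ¬c F ∈ t ⇔ (F ∉ t)
  Local t (F ⊓ G)  = F ⊓ G ∈ t ⇔ (F ∈ t × G ∈ t)
  Local t (F ⊔ G)  = F ⊔ G ∈ t ⇔ (F ∈ t ⊎ G ∈ t)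
  Local t _        = ⊤

  local? : ∀ t E → Dec (Local t E)
  local? t ⊤c       = ⊤c ∈? t ⇔? yes tt
  local? t ⊥c       = ⊥c ∈? t ⇔? no λ ()
  local? t (¬c F)   = ¬c F ∈? t ⇔? ¬? (F ∈? t)
  local? t (F ⊓ G)  = F ⊓ G ∈? t ⇔? F ∈? t ×-dec G ∈? t
  local? t (F ⊔ G)  = F ⊔ G ∈? t ⇔? F ∈? t ⊎-dec G ∈? t
  local? t (atom _) = yes tt
  local? t (∃c _ _) = yes tt
  local? t (∀c _ _) = yes tt

  LocallyConsistent : List Concept → Set
  LocallyConsistent t = All (Local t) sub × All (λ (C , D) → C ∈ t → D ∈ t) (cis O)

  locallyConsistent? : ∀ t → Dec (LocallyConsistent t)
  locallyConsistent? t = all? (local? t) sub ×-dec all? (λ (C , D) → C ∈? t →-dec D ∈? t) (cis O)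

  -- Imposing the conditions of every super-role s of r makes the role inclusions hold
  -- in the canonical model.
  EdgeCondition : RoleName → List Concept → List Concept → Concept → Set
  EdgeCondition r t t′ (∃c s F) = r ⊑* s → F ∈ t′ → ∃c s F ∈ t
  EdgeCondition r t t′ (∀c s F) = r ⊑* s → ∀c s F ∈ t → F ∈ t′
  EdgeCondition r t t′ _        = ⊤

  edgeCondition? : ∀ r t t′ E → Dec (EdgeCondition r t t′ E)
  edgeCondition? r t t′ (∃c s F) = reachable? ℕ._≟_ (ris O) r s →-dec F ∈? t′ →-dec ∃c s F ∈? t
  edgeCondition? r t t′ (∀c s F) = reachable? ℕ._≟_ (ris O) r s →-dec ∀c s F ∈? t →-dec F ∈? t′
  edgeCondition? r t t′ ⊤c       = yes tt
  edgeCondition? r t t′ ⊥c       = yes tt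
  edgeCondition? r t t′ (atom _) = yes tt
  edgeCondition? r t t′ (¬c _)   = yes tt
  edgeCondition? r t t′ (_ ⊓ _)  = yes tt
  edgeCondition? r t t′ (_ ⊔ _)  = yes tt

  Edge : RoleName → List Concept → List Concept → Set
  Edge r t t′ = All (EdgeCondition r t t′) sub

  edge? : ∀ r t t′ → Dec (Edge r t t′)
  edge? r t t′ = all? (edgeCondition? r t t′) sub

  Demand : List (List Concept) → List Concept → Concept → Set
  Demand L t (∃c r F) = ∃c r F ∈ t → Any (λ t′ → Edge r t t′ × F ∈ t′) L
  Demand L t (∀c r F) = ∀c r F ∉ t → Any (λ t′ → Edge r t t′ × F ∉ t′) L
  Demand L t _        = ⊤

  demand? : ∀ L t E → Dec (Demand L t E)
  demand? L t (∃c r F) = ∃c r F ∈? t →-dec any? (λ t′ → edge? r t t′ ×-dec F ∈? t′) L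
  demand? L t (∀c r F) = ¬? (∀c r F ∈? t) →-dec any? (λ t′ → edge? r t t′ ×-dec ¬? (F ∈? t′)) L
  demand? L t ⊤c       = yes tt
  demand? L t ⊥c       = yes tt
  demand? L t (atom _) = yes tt
  demand? L t (¬c _)   = yes tt
  demand? L t (_ ⊓ _)  = yes tt
  demand? L t (_ ⊔ _)  = yes tt

  Witnessed : List (List Concept) → List Concept → Set
  Witnessed L t = All (Demand L t) sub

  witnessed? : ∀ L t → Dec (Witnessed L t)
  witnessed? L t = all? (demand? L t) sub

  candidates : List (List Concept)
  candidates = filter locallyConsistent? (sublists sub)

  open Pruning Witnessed witnessed?

  types : List (List Concept)
  types = prune candidates

  ∈types⇒candidate : ∀ {t} → t ∈ types → t ∈ sublists sub × LocallyConsistent t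
  ∈types⇒candidate = ∈-filter⁻ locallyConsistent? ∘ prune-⊆ candidates

  ∈types⇒Local : ∀ {t E} → t ∈ types → InSub O C₀ D₀ E → Local t E
  ∈types⇒Local t∈ E∈ = All.lookup (proj₁ (proj₂ (∈types⇒candidate t∈))) (InSub⇒∈ E∈)

  ∈types⇒Demand : ∀ {t E} → t ∈ types → InSub O C₀ D₀ E → Demand types t E
  ∈types⇒Demand t∈ E∈ = All.lookup (All.lookup (prune-stable candidates) t∈) (InSub⇒∈ E∈)

  Holds : Concept → List Concept → Set
  Holds ⊤c       _ = ⊤
  Holds ⊥c       _ = ⊥
  Holds (atom A) t = atom A ∈ t
  Holds (¬c C)   t = ¬ Holds C t
  Holds (C ⊓ D)  t = Holds C t × Holds D t
  Holds (C ⊔ D)  t = Holds C t ⊎ Holds D t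
  Holds (∃c r C) t = Any (λ t′ → Edge r t t′ × Holds C t′) types
  Holds (∀c r C) t = All (λ t′ → Edge r t t′ → Holds C t′) types

  holds? : ∀ C t → Dec (Holds C t)
  holds? ⊤c       _ = yes tt
  holds? ⊥c       _ = no λ ()
  holds? (atom A) t = atom A ∈? t
  holds? (¬c C)   t = ¬? (holds? C t)
  holds? (C ⊓ D)  t = holds? C t ×-dec holds? D t
  holds? (C ⊔ D)  t = holds? C t ⊎-dec holds? D t
  holds? (∃c r C) t = any? (λ t′ → edge? r t t′ ×-dec holds? C t′) types
  holds? (∀c r C) t = all? (λ t′ → edge? r t t′ →-dec holds? C t′) types

  canonical : Interp
  canonical = record
    { Δ      = Σ (List Concept) (_∈ types)
    ; ext    = λ C (t , _) → does (holds? C t)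
    ; rol    = λ r (t , _) (t′ , _) → Edge r t t′
    ; ext-⊤  = λ _ → refl
    ; ext-⊥  = λ _ → refl
    ; ext-¬  = λ _ _ → refl
    ; ext-⊓  = λ _ _ _ → refl
    ; ext-⊔  = λ _ _ _ → refl
    ; ext-∃⇒ = λ r C (t , _) t∈ →
        let t′ , t′∈ , tt′ , t′∈C = find (dec-true⁻¹ (holds? (∃c r C) t) t∈)
        in (t′ , t′∈) , tt′ , dec-true (holds? C t′) t′∈C
    ; ext-∃⇐ = λ r C (t , _) (t′ , t′∈) tt′ t′∈C →
        dec-true (holds? (∃c r C) t) (lose t′∈ (tt′ , dec-true⁻¹ (holds? C t′) t′∈C))
    ; ext-∀⇒ = λ r C (t , _) t∈ (t′ , t′∈) tt′ →
        dec-true (holds? C t′) (All.lookup (dec-true⁻¹ (holds? (∀c r C) t) t∈) t′∈ tt′)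
    ; ext-∀⇐ = λ r C (t , _) succ∈ → dec-true (holds? (∀c r C) t)
        (All.tabulate λ {t′} t′∈ tt′ → dec-true⁻¹ (holds? C t′) (succ∈ (t′ , t′∈) tt′))
    }

  truth : ∀ {E t} → InSub O C₀ D₀ E → t ∈ types → Holds E t ⇔ E ∈ t
  truth {⊤c}     E∈ t∈ = ⇔-sym (∈types⇒Local t∈ E∈)
  truth {⊥c}     E∈ t∈ = ⇔-sym (∈types⇒Local t∈ E∈)
  truth {atom _} E∈ t∈ = ⇔-id _
  truth {¬c F}   E∈ t∈ = ⇔-sym (∈types⇒Local t∈ E∈) ⇔-∘ ¬-cong-⇔ (truth (InSub-¬ E∈) t∈)
  truth {F ⊓ G}  E∈ t∈ =
    let F∈ , G∈ = InSub-⊓ E∈ in ⇔-sym (∈types⇒Local t∈ E∈) ⇔-∘ (truth F∈ t∈ ×-⇔ truth G∈ t∈)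
  truth {F ⊔ G}  E∈ t∈ =
    let F∈ , G∈ = InSub-⊔ E∈ in ⇔-sym (∈types⇒Local t∈ E∈) ⇔-∘ (truth F∈ t∈ ⊎-⇔ truth G∈ t∈)
  truth {∃c r F} {t} E∈ t∈ = mk⇔ holds⇒∈ ∈⇒holds
    where
    holds⇒∈ : Holds (∃c r F) t → ∃c r F ∈ t
    holds⇒∈ succ with t′ , t′∈ , tt′ , t′⊨F ← find succ =
      All.lookup tt′ (InSub⇒∈ E∈) ε (to (truth (InSub-∃ E∈) t′∈) t′⊨F)
    ∈⇒holds : ∃c r F ∈ t → Holds (∃c r F) t
    ∈⇒holds ∃rF∈ with t′ , t′∈ , tt′ , F∈t′ ← find (∈types⇒Demand t∈ E∈ ∃rF∈) =
      lose t′∈ (tt′ , from (truth (InSub-∃ E∈) t′∈) F∈t′)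
  truth {∀c r F} {t} E∈ t∈ = mk⇔ holds⇒∈ ∈⇒holds
    where
    holds⇒∈ : Holds (∀c r F) t → ∀c r F ∈ t
    holds⇒∈ succ with ∀c r F ∈? t
    ... | yes ∀rF∈ = ∀rF∈
    ... | no ∀rF∉ with t′ , t′∈ , tt′ , F∉t′ ← find (∈types⇒Demand t∈ E∈ ∀rF∉) =
      ⊥-elim (F∉t′ (to (truth (InSub-∀ E∈) t′∈) (All.lookup succ t′∈ tt′)))
    ∈⇒holds : ∀c r F ∈ t → Holds (∀c r F) t
    ∈⇒holds ∀rF∈ = All.tabulate λ t′∈ tt′ →
      from (truth (InSub-∀ E∈) t′∈) (All.lookup tt′ (InSub⇒∈ E∈) ε ∀rF∈)

  Edge-⊑ : ∀ {r s t t′} → (r , s) ∈ ris O → Edge r t t′ → Edge s t t′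
  Edge-⊑ {r} {s} {t} {t′} rs = All.map λ {E} → weaken E
    where
    weaken : ∀ E → EdgeCondition r t t′ E → EdgeCondition s t t′ E
    weaken (∃c u F) cond s⊑u = cond (rs ◅ s⊑u)
    weaken (∀c u F) cond s⊑u = cond (rs ◅ s⊑u)
    weaken ⊤c       _ = tt
    weaken ⊥c       _ = tt
    weaken (atom _) _ = tt
    weaken (¬c _)   _ = tt
    weaken (_ ⊓ _)  _ = tt
    weaken (_ ⊔ _)  _ = tt

  canonical-model : IsModel O canonical
  canonical-model = All.tabulate inclusion , All.tabulate (λ rs _ _ → Edge-⊑ rs)
    where
    inclusion : ∀ {CD} → CD ∈ cis O → ∀ d →
                ext canonical (proj₁ CD) d ≡ true → ext canonical (proj₂ CD) d ≡ true
    inclusion {C , D} CD∈ (t , t∈) t⊨C =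
      dec-true (holds? D t) (from (truth (occ (inRhs CD∈ refl)) t∈)
        (All.lookup (proj₂ (proj₂ (∈types⇒candidate t∈))) CD∈
          (to (truth (occ (inLhs CD∈ refl)) t∈) (dec-true⁻¹ (holds? C t) t⊨C))))

  ∈types⇒IsType : ∀ {t} → t ∈ types → IsType O C₀ D₀ t
  ∈types⇒IsType {t} t∈ =
    All.tabulate (∈⇒InSub ∘ ∈-sublists⇒⊆ (proj₁ (∈types⇒candidate t∈))) ,
    canonical , canonical-model , (t , t∈) ,
    λ E E∈ → (dec-true (holds? E t) ∘ from (truth E∈ t∈)) , (to (truth E∈ t∈) ∘ dec-true⁻¹ (holds? E t))

  module Realised (I : Interp) (M : IsModel O I) where
    open Semantics I

    typeOf : Δ I → List Concept
    typeOf d = filter (d ∈⟦_⟧?) sub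

    ∈typeOf : ∀ {E d} → InSub O C₀ D₀ E → E ∈ typeOf d ⇔ d ∈⟦ E ⟧
    ∈typeOf {d = d} E∈ = mk⇔ (proj₂ ∘ ∈-filter⁻ (d ∈⟦_⟧?)) (∈-filter⁺ (d ∈⟦_⟧?) (InSub⇒∈ E∈))

    ∈⟦typeOf⟧ : ∀ d → d ∈⟦ conj (typeOf d) ⟧
    ∈⟦typeOf⟧ d = from (∈⟦conj⟧ {typeOf d}) (All.tabulate (proj₂ ∘ ∈-filter⁻ (d ∈⟦_⟧?)))

    ⊑*-rol : ∀ {r s d e} → r ⊑* s → rol I r d e → rol I s d e
    ⊑*-rol ε         de = de
    ⊑*-rol (rs ◅ r⊑s) de = ⊑*-rol r⊑s (All.lookup (proj₂ M) rs _ _ de)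

    typeOf-local : ∀ {E} d → InSub O C₀ D₀ E → Local (typeOf d) E
    typeOf-local {⊤c}     d E∈ = mk⇔ _ (λ _ → from (∈typeOf E∈) ∈⟦⊤⟧)
    typeOf-local {⊥c}     d E∈ = mk⇔ (∉⟦⊥⟧ ∘ to (∈typeOf E∈)) ⊥-elim
    typeOf-local {¬c F}   d E∈ = ¬-cong-⇔ (⇔-sym (∈typeOf (InSub-¬ E∈))) ⇔-∘ (∈⟦¬⟧ ⇔-∘ ∈typeOf E∈)
    typeOf-local {F ⊓ G}  d E∈ = let F∈ , G∈ = InSub-⊓ E∈ in
      (⇔-sym (∈typeOf F∈) ×-⇔ ⇔-sym (∈typeOf G∈)) ⇔-∘ (∈⟦⊓⟧ ⇔-∘ ∈typeOf E∈)
    typeOf-local {F ⊔ G}  d E∈ = let F∈ , G∈ = InSub-⊔ E∈ in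
      (⇔-sym (∈typeOf F∈) ⊎-⇔ ⇔-sym (∈typeOf G∈)) ⇔-∘ (∈⟦⊔⟧ ⇔-∘ ∈typeOf E∈)
    typeOf-local {atom _} d E∈ = tt
    typeOf-local {∃c _ _} d E∈ = tt
    typeOf-local {∀c _ _} d E∈ = tt

    typeOf-consistent : ∀ d → LocallyConsistent (typeOf d)
    typeOf-consistent d = All.tabulate (typeOf-local d ∘ ∈⇒InSub) , All.tabulate inclusion
      where
      inclusion : ∀ {CD} → CD ∈ cis O → proj₁ CD ∈ typeOf d → proj₂ CD ∈ typeOf d
      inclusion CD∈ C∈ = from (∈typeOf (occ (inRhs CD∈ refl)))
        (All.lookup (proj₁ M) CD∈ d (to (∈typeOf (occ (inLhs CD∈ refl))) C∈))

    typeOf-edge : ∀ {r d e} → rol I r d e → Edge r (typeOf d) (typeOf e)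
    typeOf-edge {r} {d} {e} de = All.tabulate λ E∈ → condition _ (∈⇒InSub E∈)
      where
      condition : ∀ E → InSub O C₀ D₀ E → EdgeCondition r (typeOf d) (typeOf e) E
      condition (∃c s F) E∈ r⊑s F∈ =
        from (∈typeOf E∈) (ext-∃⇐ I s F d e (⊑*-rol r⊑s de) (to (∈typeOf (InSub-∃ E∈)) F∈))
      condition (∀c s F) E∈ r⊑s ∀sF∈ =
        from (∈typeOf (InSub-∀ E∈)) (ext-∀⇒ I s F d (to (∈typeOf E∈) ∀sF∈) e (⊑*-rol r⊑s de))
      condition ⊤c       _ = tt
      condition ⊥c       _ = tt
      condition (atom _) _ = tt
      condition (¬c _)   _ = tt
      condition (_ ⊓ _)  _ = tt
      condition (_ ⊔ _)  _ = tt

    typeOf-witnessed : ∀ {L} → (∀ d → typeOf d ∈ L) → ∀ d → Witnessed L (typeOf d)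
    typeOf-witnessed {L} realised∈L d = All.tabulate λ E∈ → demand _ (∈⇒InSub E∈)
      where
      demand : ∀ E → InSub O C₀ D₀ E → Demand L (typeOf d) E
      demand (∃c r F) E∈ ∃rF∈ =
        let e , de , e∈F = ext-∃⇒ I r F d (to (∈typeOf E∈) ∃rF∈)
        in lose (realised∈L e) (typeOf-edge de , from (∈typeOf (InSub-∃ E∈)) e∈F)
      demand (∀c r F) E∈ ∀rF∉ =
        let e , de , e∉F = ∉⟦∀⟧⇒counterexample (∀rF∉ ∘ from (∈typeOf E∈))
        in lose (realised∈L e) (typeOf-edge de , e∉F ∘ to (∈typeOf (InSub-∀ E∈)))
      demand ⊤c       _ = tt
      demand ⊥c       _ = tt
      demand (atom _) _ = tt
      demand (¬c _)   _ = tt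
      demand (_ ⊓ _)  _ = tt
      demand (_ ⊔ _)  _ = tt

    typeOf-∈types : ∀ d → typeOf d ∈ types
    typeOf-∈types = prune-keeps typeOf typeOf-witnessed candidates λ d →
      ∈-filter⁺ locallyConsistent? (filter-∈-sublists (d ∈⟦_⟧?) sub) (typeOf-consistent d)

conjuncts : Concept → List Concept
conjuncts (C ⊓ D) = C ∷ conjuncts D
conjuncts _       = []

conjuncts-conj : ∀ Cs → conjuncts (conj Cs) ≡ Cs
conjuncts-conj []       = refl
conjuncts-conj (C ∷ Cs) = cong (C ∷_) (conjuncts-conj Cs)

separable⇒covering-separable : ∀ {O Σs 𝒞} → Separable O Σs 𝒞 →
  (T : List (List Concept)) → All (λ C → Any (C ∈_) T) 𝒞 → Separable O Σs (map conj T)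
separable⇒covering-separable {O} {Σs} {𝒞} (Sep , Sep-ok , Sep-disjoint) T covers =
  Sep′ ∘ conjuncts , All.map⁺ (All.tabulate ok) , disjoint
  where
  open Equivalence using (to; from)

  Sep′ : List Concept → Concept
  Sep′ t = conj (map Sep (filter (_∈? t) 𝒞))

  Sep′-conj : ∀ t → Sep′ (conjuncts (conj t)) ≡ Sep′ t
  Sep′-conj t = cong Sep′ (conjuncts-conj t)

  ok : ∀ {t} → t ∈ T → InSig Σs (Sep′ (conjuncts (conj t))) × O ⊨ conj t ⊑ Sep′ (conjuncts (conj t))
  ok {t} _ rewrite Sep′-conj t =
    conj-InSig (All.map⁺ (All.filter⁺ (_∈? t) (All.map proj₁ Sep-ok))) ,
    λ I M d d∈t → let open Semantics I in
      from ∈⟦conj-map⟧ (All.tabulate λ C∈ → let C∈𝒞 , C∈t = ∈-filter⁻ (_∈? t) C∈ in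
        proj₂ (All.lookup Sep-ok C∈𝒞) I M d (All.lookup (to ∈⟦conj⟧ d∈t) C∈t))

  disjoint : O ⊨ conj (map (Sep′ ∘ conjuncts) (map conj T)) ⊑ ⊥c
  disjoint I M d d∈ = Sep-disjoint I M d (from ∈⟦conj-map⟧ (All.tabulate d∈Sep))
    where
    open Semantics I
    d∈Sep′ : ∀ {t} → t ∈ T → d ∈⟦ Sep′ t ⟧
    d∈Sep′ {t} t∈T = subst (d ∈⟦_⟧) (Sep′-conj t) (All.lookup (All.map⁻ (to ∈⟦conj-map⟧ d∈)) t∈T)
    d∈Sep : ∀ {C} → C ∈ 𝒞 → d ∈⟦ Sep C ⟧
    d∈Sep C∈𝒞 with t , t∈T , C∈t ← find (All.lookup covers C∈𝒞) =
      All.lookup (to ∈⟦conj-map⟧ (d∈Sep′ t∈T)) (∈-filter⁺ (_∈? t) C∈𝒞 C∈t)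

module FromCompletions (O : Ontology) (C₀ D₀ : Concept) (Σs : Signature) (𝒞 : List Concept)
  (H : (T : List (List Concept)) → IsMosaicCompletion O C₀ D₀ 𝒞 T → MosaicSeparable O Σs T) where
  open TypeElimination O C₀ D₀
  open Equivalence using (to; from)

  Admissible : List (List Concept) → Set
  Admissible T = All (_∈ types) T × All (λ C → Any (C ∈_) T) 𝒞

  admissible? : ∀ T → Dec (Admissible T)
  admissible? T = all? (_∈ᴸ? types) T ×-dec all? (λ C → any? (C ∈?_) T) 𝒞

  -- ⊤c is a junk value: the disjointness of a mosaic's separators is only used for admissible ones.
  separatorFor : ∀ T → Dec (Admissible T) → Concept → Concept
  separatorFor T (yes (T⊆ , covers)) = proj₁ (H T (All.map ∈types⇒IsType T⊆ , covers))
  separatorFor T (no _)              = λ _ → ⊤c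

  separatorFor-ok : ∀ T T? {t} → t ∈ T →
    InSig Σs (separatorFor T T? (conj t)) × O ⊨ conj t ⊑ separatorFor T T? (conj t)
  separatorFor-ok T (yes _) t∈ = All.lookup (proj₁ (proj₂ (H T _))) (∈-map⁺ conj t∈)
  separatorFor-ok T (no _)  t∈ = ⊤s , λ I _ d _ → ext-⊤ I d

  separatorFor-disjoint : ∀ T → Admissible T →
    O ⊨ conj (map (separatorFor T (admissible? T)) (map conj T)) ⊑ ⊥c
  separatorFor-disjoint T admissible with admissible? T
  ... | yes _          = proj₂ (proj₂ (H T _))
  ... | no ¬admissible = ⊥-elim (¬admissible admissible)

  mosaicsContaining : List Concept → List (List (List Concept))
  mosaicsContaining t = filter (t ∈ᴸ?_) (sublists types)

  mosaicsContaining⁻ : ∀ {t T} → T ∈ mosaicsContaining t → t ∈ T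
  mosaicsContaining⁻ {t} = proj₂ ∘ ∈-filter⁻ (t ∈ᴸ?_) {xs = sublists types}

  typeSeparator : List Concept → Concept
  typeSeparator t = conj (map (λ T → separatorFor T (admissible? T) (conj t)) (mosaicsContaining t))

  Sep : Concept → Concept
  Sep C = disj (map typeSeparator (filter (C ∈?_) types))

  module _ (I : Interp) where
    open Semantics I

    ∈⟦typeSeparator⟧ : ∀ {d t} → d ∈⟦ typeSeparator t ⟧ ⇔
      All (λ T → d ∈⟦ separatorFor T (admissible? T) (conj t) ⟧) (mosaicsContaining t)
    ∈⟦typeSeparator⟧ {t = t} = ∈⟦conj-map⟧ {xs = mosaicsContaining t}

    ∈⟦Sep⟧ : ∀ {d C} → d ∈⟦ Sep C ⟧ ⇔ Any (λ t → d ∈⟦ typeSeparator t ⟧) (filter (C ∈?_) types)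
    ∈⟦Sep⟧ {C = C} = ∈⟦disj-map⟧ {xs = filter (C ∈?_) types}

  Sep-InSig : ∀ C → InSig Σs (Sep C)
  Sep-InSig C =
    disj-InSig (All.map⁺ {xs = filter (C ∈?_) types} (All.tabulate λ _ → typeSeparator-InSig _))
    where
    typeSeparator-InSig : ∀ t → InSig Σs (typeSeparator t)
    typeSeparator-InSig t = conj-InSig (All.map⁺ {xs = mosaicsContaining t}
      (All.tabulate λ T∈ → proj₁ (separatorFor-ok _ (admissible? _) (mosaicsContaining⁻ T∈))))

  Sep-sound : ∀ {C} → InSub O C₀ D₀ C → O ⊨ C ⊑ Sep C
  Sep-sound {C} C∈sub I M d d∈C =
    from (∈⟦Sep⟧ I)
      (lose (∈-filter⁺ (C ∈?_) (typeOf-∈types d) (from (∈typeOf C∈sub) d∈C)) d∈typeSeparator)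
    where
    open Semantics I
    open Realised I M
    d∈typeSeparator : d ∈⟦ typeSeparator (typeOf d) ⟧
    d∈typeSeparator = from (∈⟦typeSeparator⟧ I) (All.tabulate λ T∈ →
      proj₂ (separatorFor-ok _ (admissible? _) (mosaicsContaining⁻ T∈)) I M d (∈⟦typeOf⟧ d))

  Sep-disjoint : O ⊨ conj (map Sep 𝒞) ⊑ ⊥c
  Sep-disjoint I M d d∈ =
    separatorFor-disjoint T admissible I M d
      (from (∈⟦conj-map⟧ {xs = map conj T}) (All.map⁺ (All.tabulate d∈separator)))
    where
    open Semantics I
    d∈typeSeparator? : ∀ t → Dec (d ∈⟦ typeSeparator t ⟧)
    d∈typeSeparator? t = d ∈⟦ typeSeparator t ⟧?

    T : List (List Concept)
    T = filter d∈typeSeparator? types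

    covered : ∀ {C} → C ∈ 𝒞 → Any (C ∈_) T
    covered {C} C∈𝒞 with t , t∈ , d∈t ← find (to (∈⟦Sep⟧ I) (All.lookup (to ∈⟦conj-map⟧ d∈) C∈𝒞)) =
      let t∈types , C∈t = ∈-filter⁻ (C ∈?_) {xs = types} t∈
      in lose (∈-filter⁺ d∈typeSeparator? t∈types d∈t) C∈t

    admissible : Admissible T
    admissible = All.tabulate (proj₁ ∘ ∈-filter⁻ d∈typeSeparator?) , All.tabulate covered

    d∈separator : ∀ {t} → t ∈ T → d ∈⟦ separatorFor T (admissible? T) (conj t) ⟧
    d∈separator {t} t∈T =
      All.lookup (to (∈⟦typeSeparator⟧ I) (proj₂ (∈-filter⁻ d∈typeSeparator? {xs = types} t∈T)))
        (∈-filter⁺ (t ∈ᴸ?_) (filter-∈-sublists d∈typeSeparator? types) t∈T)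

  separable : All (InSub O C₀ D₀) 𝒞 → Separable O Σs 𝒞
  separable 𝒞⊆sub =
    Sep , All.tabulate (λ C∈ → Sep-InSig _ , Sep-sound (All.lookup 𝒞⊆sub C∈)) , Sep-disjoint

lemma3 : (O : Ontology) (C₀ D₀ : Concept) (Σs : Signature) (𝒞 : List Concept) →
    All (InSub O C₀ D₀) 𝒞 →
    (Separable O Σs 𝒞 → ((T : List (List Concept)) → IsMosaicCompletion O C₀ D₀ 𝒞 T → MosaicSeparable O Σs T)) ×
    (((T : List (List Concept)) → IsMosaicCompletion O C₀ D₀ 𝒞 T → MosaicSeparable O Σs T) → Separable O Σs 𝒞)
lemma3 O C₀ D₀ Σs 𝒞 𝒞⊆sub =
  (λ 𝒞-separable T (_ , covers) → separable⇒covering-separable 𝒞-separable T covers) ,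
  (λ H → FromCompletions.separable O C₀ D₀ Σs 𝒞 H 𝒞⊆sub)
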